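{- Let $T'$ be a finite tree with $2n$ leaves, $n\ge 1$, and let $\mathcal{L}$ be its set of leaves. Then for any balanced vertex $v$ of $T'$ there exists a bijection $\alpha:\mathcal{L}\to\mathcal{L}$ such that the paths $P_{\ell,\alpha(\ell)}$ ($\ell\in\mathcal{L}$) cover all edges of $T'$, and all these paths contain $v$.
   Context: For vertices $u,v$ of a tree, $P_{u,v}$ denotes the unique path between $u$ and $v$. For a vertex $v$ and an edge $e$ with $v\in e$, $\delta(v,e)$ denotes the number of leaves $\ell$ of the tree such that $P_{v,\ell}$ contains the edge $e$. $E(v)$ denotes the set of edges incident to $v$. A vertex $v$ is balanced if for every $e\in E(v)$ one has $\delta(v,e)\le \sum\{\delta(v,f): f\in E(v),\ f\ne e\}$. -}

module Defs where

open import Data.Nat using (ℕ; zero; suc; _+_; _≤_)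
open import Data.Bool using (Bool; true; false; if_then_else_; _∧_; not)
open import Data.Fin using (Fin; _≟_)
open import Data.List using (List; []; _∷_; length; map; allFin)
open import Data.Nat.ListAction using (sum)
open import Data.List.Membership.Propositional using (_∈_)
open import Data.List.Relation.Unary.Unique.Propositional using (Unique)
open import Data.Product using (Σ; ∃; _×_; _,_)
open import Data.Sum using (_⊎_)
open import Data.Empty using (⊥)
open import Relation.Nullary using (¬_)
open import Relation.Nullary.Decidable using (⌊_⌋)
open import Relation.Binary.PropositionalEquality using (_≡_)

record Graph : Set where
  field
    m     : ℕ
    adj   : Fin m → Fin m → Bool
    sym   : ∀ x y → adj x y ≡ adj y x
    irr   : ∀ x → adj x x ≡ false

module _ (G : Graph) where
  open Graph G

  Vertex : Set
  Vertex = Fin m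

  Edge : Vertex → Vertex → Set
  Edge a b = adj a b ≡ true

  Card : (Vertex → Set) → ℕ → Set
  Card P k = Σ (List Vertex) λ xs →
    Unique xs × length xs ≡ k × (∀ x → x ∈ xs → P x) × (∀ x → P x → x ∈ xs)

  -- Walks from u to v, recorded by their list of vertices (u first, v last).
  data Walk : Vertex → Vertex → List Vertex → Set where
    here : ∀ {u} → Walk u u (u ∷ [])
    step : ∀ {u w v xs} → Edge u w → Walk w v xs → Walk u v (u ∷ xs)

  IsPath : Vertex → Vertex → List Vertex → Set
  IsPath u v xs = Walk u v xs × Unique xs

  Connected : Set
  Connected = ∀ u v → ∃ λ xs → IsPath u v xs

  -- A cycle: a path x₀ … x_k with k ≥ 2 together with the edge {x_k , x₀}.
  HasCycle : Set
  HasCycle = Σ Vertex λ u → Σ Vertex λ v → Σ Vertex λ a → Σ Vertex λ b →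
    Σ (List Vertex) λ xs → IsPath u v (u ∷ a ∷ b ∷ xs) × Edge v u

  IsTree : Set
  IsTree = Connected × ¬ HasCycle

  data Consec (a b : Vertex) : List Vertex → Set where
    now   : ∀ {xs} → Consec a b (a ∷ b ∷ xs)
    later : ∀ {x xs} → Consec a b xs → Consec a b (x ∷ xs)

  EdgeOn : Vertex → Vertex → List Vertex → Set
  EdgeOn a b xs = Consec a b xs ⊎ Consec b a xs

  -- P_{u,v} contains the edge {a , b}  (in a tree the path is unique)
  PathHasEdge : Vertex → Vertex → Vertex → Vertex → Set
  PathHasEdge u v a b = ∃ λ xs → IsPath u v xs × EdgeOn a b xs

  PathHasVertex : Vertex → Vertex → Vertex → Set
  PathHasVertex u v x = ∃ λ xs → IsPath u v xs × x ∈ xs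

  Leaf : Vertex → Set
  Leaf ℓ = Card (Edge ℓ) 1

  -- δ(v, {v,w}) = d  :  number of leaves ℓ with {v,w} on P_{v,ℓ}
  Delta : Vertex → Vertex → ℕ → Set
  Delta v w d = Card (λ ℓ → Leaf ℓ × PathHasEdge v ℓ v w) d

  sumOtherNbrs : Vertex → Vertex → (Vertex → ℕ) → ℕ
  sumOtherNbrs v w d =
    sum (map (λ w' → if adj v w' ∧ not ⌊ w' ≟ w ⌋ then d w' else 0) (allFin m))

  -- v is balanced: with d w = δ(v,{v,w}) for every neighbour w of v,
  -- d w ≤ Σ_{w' neighbour, w' ≠ w} d w'.
  Balanced : Vertex → Set
  Balanced v = (d : Vertex → ℕ) → (∀ w → Edge v w → Delta v w (d w)) →
    ∀ w → Edge v w → d w ≤ sumOtherNbrs v w d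

-- Root the tree at v.  A vertex x ≠ v lies in the branch of the neighbour
-- `branch x` of v through which the path from v to x leaves v, and δ(v,{v,w})
-- is the number of leaves in the branch of w.  The branch sizes add up to 2n,
-- so balance gives 2δ(v,w) ≤ 2n: no branch holds more than n leaves (and v is
-- not a leaf).  Sort the leaves by branch as m₁ … m₂ₙ and let α exchange mᵢ
-- and mₙ₊ᵢ.  If both were in one branch, so would be the n+1 leaves between
-- them; so α changes the branch, and P_{ℓ,αℓ} is the reversed path from v to ℓ
-- followed by the path from v to αℓ, passing through v.  Every edge lies on a
-- path from v to some leaf ℓ (extend away from v; there are no cycles), hence
-- on P_{ℓ,αℓ}.
module Submission where

open import Defs
open import Data.Bool using (Bool; true; false; if_then_else_; _∧_; not) renaming (_≟_ to _≟B_)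
open import Data.Empty using (⊥-elim)
open import Data.Fin using (toℕ) renaming (_≟_ to _≟F_)
open import Data.Fin.Properties using (any?; toℕ-injective; toℕ<n)
open import Data.List using (List; []; _∷_; _++_; _∷ʳ_; length; filter; map; zip; take; drop; reverse; allFin)
open import Data.List.Properties using (++-assoc; ++-identityʳ; unfold-reverse; length-++; length-take; length-drop; length-tabulate; map-++; map-cong; take++drop≡id; filter-some)
open import Data.List.Membership.Propositional using (_∈_; _∉_)
open import Data.List.Membership.Propositional.Properties using (∈-∃++; ∈-++⁻; ∈-++⁺ˡ; ∈-++⁺ʳ; ∈-map⁺; ∈-map⁻; ∈-filter⁺; ∈-filter⁻; ∈-allFin)
open import Data.List.Relation.Binary.Subset.Propositional using (_⊆_)
open import Data.List.Relation.Binary.Permutation.Propositional using (↭-sym; ↭⇒↭ₛ)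
open import Data.List.Relation.Binary.Permutation.Propositional.Properties using (shift; ↭-length; ↭-reverse)
import Data.List.Relation.Binary.Permutation.Setoid.Properties as PermProps
open import Data.List.Relation.Unary.All as All using (All; []; _∷_)
import Data.List.Relation.Unary.All.Properties as AllP
open import Data.List.Relation.Unary.AllPairs using (AllPairs; []; _∷_)
import Data.List.Relation.Unary.AllPairs.Properties as AllPairsP
open import Data.List.Relation.Unary.Any as Any using (Any; here; there)
import Data.List.Relation.Unary.Any.Properties as AnyP
open import Data.List.Relation.Unary.Unique.Propositional using (Unique)
import Data.List.Relation.Unary.Unique.Propositional.Properties as UniqueP
open import Data.Nat using (ℕ; zero; suc; _+_; _*_; _∸_; _≤_; _<_; _≥_; z≤n; s≤s; _⊓_) renaming (_≟_ to _≟ℕ_)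
open import Data.Nat.ListAction using (sum)
open import Data.Nat.Properties
open import Algebra.Properties.CommutativeSemigroup +-commutativeSemigroup using (interchange)
open import Data.Product using (Σ; ∃; _×_; _,_; proj₁; proj₂)
open import Data.Sum using (_⊎_; inj₁; inj₂)
open import Data.Unit using (⊤; tt)
open import Function using (_∘_)
open import Relation.Binary.Definitions using (DecidableEquality)
open import Relation.Binary.PropositionalEquality
open import Relation.Nullary using (¬_; yes; no; ¬?)
open import Relation.Nullary.Decidable using (_×-dec_; ⌊_⌋)

module ListFacts {A : Set} where

  unique-⊆-length : ∀ {xs ys : List A} → Unique xs → xs ⊆ ys → length xs ≤ length ys
  unique-⊆-length {[]} _ _ = z≤n
  unique-⊆-length {x ∷ xs} (x∉xs ∷ uxs) xs⊆ys with ∈-∃++ (xs⊆ys (here refl))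
  ... | P , Q , refl = begin
      suc (length xs)        ≤⟨ s≤s (unique-⊆-length uxs xs⊆P++Q) ⟩
      suc (length (P ++ Q))  ≡⟨ ↭-length (↭-sym (shift x P Q)) ⟩
      length (P ++ x ∷ Q)    ∎
    where
      open ≤-Reasoning
      xs⊆P++Q : xs ⊆ P ++ Q
      xs⊆P++Q {z} z∈xs with ∈-++⁻ P (xs⊆ys (there z∈xs))
      ... | inj₁ z∈P = ∈-++⁺ˡ z∈P
      ... | inj₂ (here refl) = ⊥-elim (All.lookup x∉xs z∈xs refl)
      ... | inj₂ (there z∈Q) = ∈-++⁺ʳ P z∈Q

  AtMost : ℕ → (A → Set) → Set
  AtMost k P = ∀ xs → Unique xs → (∀ {z} → z ∈ xs → P z) → length xs ≤ k

  atMost-⊆ : ∀ {P : A → Set} ys → (∀ {z} → P z → z ∈ ys) → AtMost (length ys) P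
  atMost-⊆ ys P⊆ys xs uxs xs⊆P = unique-⊆-length uxs (λ z∈xs → P⊆ys (xs⊆P z∈xs))

  allPairs-++ˡ : ∀ {R : A → A → Set} xs {ys} → AllPairs R (xs ++ ys) → AllPairs R xs
  allPairs-++ˡ [] _ = []
  allPairs-++ˡ (x ∷ xs) (Rx ∷ Rxs) = AllP.++⁻ˡ xs Rx ∷ allPairs-++ˡ xs Rxs

  allPairs-++ʳ : ∀ {R : A → A → Set} xs {ys} → AllPairs R (xs ++ ys) → AllPairs R ys
  allPairs-++ʳ [] Rys = Rys
  allPairs-++ʳ (x ∷ xs) (_ ∷ Rxs) = allPairs-++ʳ xs Rxs

  allPairs-across : ∀ {R : A → A → Set} xs {ys x y} → AllPairs R (xs ++ ys) →
    x ∈ xs → y ∈ ys → R x y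
  allPairs-across (x ∷ xs) (Rx ∷ _) (here refl) y∈ys = All.lookup Rx (∈-++⁺ʳ xs y∈ys)
  allPairs-across (x ∷ xs) (_ ∷ Rxs) (there x∈xs) y∈ys = allPairs-across xs Rxs x∈xs y∈ys

  unique-∷ʳ : ∀ {xs : List A} {x} → Unique xs → x ∉ xs → Unique (xs ∷ʳ x)
  unique-∷ʳ {xs} {x} uxs x∉xs = UniqueP.++⁺ {xs = xs} {ys = x ∷ []} uxs ([] ∷ []) λ { (z∈xs , here refl) → x∉xs z∈xs }

  unique-reverse : ∀ {xs : List A} → Unique xs → Unique (reverse xs)
  unique-reverse {xs} =
    PermProps.Unique-resp-↭ (setoid A) (↭⇒↭ₛ (↭-sym (↭-reverse xs)))

  zip-gap : ∀ F G S {x y} → (x , y) ∈ zip F S →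
    Σ (List A) λ P → Σ (List A) λ W → Σ (List A) λ R →
      F ++ G ++ S ≡ P ++ (x ∷ W ∷ʳ y) ++ R × suc (length W) ≡ length F + length G
  zip-gap (f ∷ F) G (s ∷ S) (here refl) =
    [] , F ++ G , S , cong (f ∷_) reassoc , cong suc (length-++ F)
    where
      reassoc : F ++ G ++ s ∷ S ≡ ((F ++ G) ∷ʳ s) ++ S
      reassoc = trans (sym (++-assoc F G (s ∷ S))) (sym (++-assoc (F ++ G) (s ∷ []) S))
  zip-gap (f ∷ F) G (s ∷ S) (there xy∈) with zip-gap F (G ∷ʳ s) S xy∈
  ... | P , W , R , eq , len = f ∷ P , W , R , cong (f ∷_) (trans reassoc eq) , len'
    where
      reassoc : F ++ G ++ s ∷ S ≡ F ++ (G ∷ʳ s) ++ S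
      reassoc = cong (F ++_) (sym (++-assoc G (s ∷ []) S))
      len' : suc (length W) ≡ suc (length F + length G)
      len' = trans len (trans (cong (length F +_) (trans (length-++ G) (+-comm (length G) 1)))
                              (+-suc (length F) (length G)))

-- An involution of F ++ S exchanging the i-th elements of F and S.
module Pairing {A : Set} (_≟_ : DecidableEquality A) where

  partnerIn : List (A × A) → A → A
  partnerIn [] x = x
  partnerIn ((a , b) ∷ ps) x with x ≟ a
  ... | yes _ = b
  ... | no _ = partnerIn ps x

  partnerIn-correct : ∀ ps {x y} → Unique (map proj₁ ps) → (x , y) ∈ ps → partnerIn ps x ≡ y
  partnerIn-correct ((a , b) ∷ ps) {x} _ _ with x ≟ a
  partnerIn-correct ((a , b) ∷ ps) _ (here refl) | yes _ = refl
  partnerIn-correct ((a , b) ∷ ps) (a∉ ∷ _) (there xy∈) | yes refl =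
    ⊥-elim (All.lookup a∉ (∈-map⁺ proj₁ xy∈) refl)
  partnerIn-correct ((a , b) ∷ ps) _ (here refl) | no x≢a = ⊥-elim (x≢a refl)
  partnerIn-correct ((a , b) ∷ ps) (_ ∷ u) (there xy∈) | no _ = partnerIn-correct ps u xy∈

  map-proj₁-zip : ∀ (xs ys : List A) → length xs ≤ length ys → map proj₁ (zip xs ys) ≡ xs
  map-proj₁-zip [] ys _ = refl
  map-proj₁-zip (x ∷ xs) (y ∷ ys) (s≤s len) = cong (x ∷_) (map-proj₁-zip xs ys len)

  zip-swap : ∀ (xs ys : List A) {x y} → (x , y) ∈ zip xs ys → (y , x) ∈ zip ys xs
  zip-swap (a ∷ xs) (b ∷ ys) (here refl) = here refl
  zip-swap (a ∷ xs) (b ∷ ys) (there p) = there (zip-swap xs ys p)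

  ZipInvolution : List A → List A → (A → A) → Set
  ZipInvolution F S α = ∀ {x} → x ∈ F ++ S →
    α x ∈ F ++ S × α (α x) ≡ x × ((x , α x) ∈ zip F S ⊎ (α x , x) ∈ zip F S)

  zipInvolution : ∀ (F S : List A) → length F ≡ length S → Unique (F ++ S) →
    Σ (A → A) (ZipInvolution F S)
  zipInvolution F S len u = partnerIn pairs , properties
    where
      pairs : List (A × A)
      pairs = zip F S ++ zip S F

      firsts : map proj₁ pairs ≡ F ++ S
      firsts = trans (map-++ proj₁ (zip F S) (zip S F))
        (cong₂ _++_ (map-proj₁-zip F S (≤-reflexive len)) (map-proj₁-zip S F (≤-reflexive (sym len))))

      pairs-sym : ∀ {x y} → (x , y) ∈ pairs → (y , x) ∈ pairs
      pairs-sym xy∈ with ∈-++⁻ (zip F S) xy∈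
      ... | inj₁ p = ∈-++⁺ʳ (zip F S) (zip-swap F S p)
      ... | inj₂ p = ∈-++⁺ˡ (zip-swap S F p)

      orient : ∀ {x y} → (x , y) ∈ pairs → (x , y) ∈ zip F S ⊎ (y , x) ∈ zip F S
      orient xy∈ with ∈-++⁻ (zip F S) xy∈
      ... | inj₁ p = inj₁ p
      ... | inj₂ p = inj₂ (zip-swap S F p)

      first∈ : ∀ {x y} → (x , y) ∈ pairs → x ∈ F ++ S
      first∈ xy∈ = subst (_ ∈_) firsts (∈-map⁺ proj₁ xy∈)

      partner : ∀ {x y} → (x , y) ∈ pairs → partnerIn pairs x ≡ y
      partner = partnerIn-correct pairs (subst Unique (sym firsts) u)

      properties : ZipInvolution F S (partnerIn pairs)
      properties x∈ with ∈-map⁻ proj₁ (subst (_ ∈_) (sym firsts) x∈)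
      ... | (x , y) , xy∈ , refl rewrite partner xy∈ =
        first∈ (pairs-sym xy∈) , partner (pairs-sym xy∈) , orient xy∈

-- Bucket sort by a natural-number key, and the separation property of
-- sorted lists in which no key is frequent.
module SortByKey {A : Set} (key : A → ℕ) where
  open ListFacts

  Sorted : List A → Set
  Sorted = AllPairs (λ a b → key a ≤ key b)

  buckets : ℕ → ℕ → List A → List A
  buckets k zero xs = []
  buckets k (suc j) xs = filter (λ x → key x ≟ℕ k) xs ++ buckets (suc k) j xs

  buckets-sound : ∀ k j xs {z} → z ∈ buckets k j xs → z ∈ xs × k ≤ key z
  buckets-sound k (suc j) xs z∈ with ∈-++⁻ (filter (λ x → key x ≟ℕ k) xs) z∈
  ... | inj₁ z∈bucket with ∈-filter⁻ (λ x → key x ≟ℕ k) {xs = xs} z∈bucket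
  ...   | z∈xs , refl = z∈xs , ≤-refl
  buckets-sound k (suc j) xs z∈ | inj₂ z∈rest with buckets-sound (suc k) j xs z∈rest
  ...   | z∈xs , k<key = z∈xs , <⇒≤ k<key

  buckets-complete : ∀ k j xs {z} → z ∈ xs → k ≤ key z → key z < k + j → z ∈ buckets k j xs
  buckets-complete k zero xs _ k≤key key<k+0 =
    ⊥-elim (<-irrefl refl (≤-trans key<k+0 (≤-trans (≤-reflexive (+-identityʳ k)) k≤key)))
  buckets-complete k (suc j) xs {z} z∈ k≤ <k+j with key z ≟ℕ k
  ... | yes refl = ∈-++⁺ˡ (∈-filter⁺ (λ x → key x ≟ℕ k) z∈ refl)
  ... | no key≢k = ∈-++⁺ʳ (filter (λ x → key x ≟ℕ k) xs)
          (buckets-complete (suc k) j xs z∈ (≤∧≢⇒< k≤ (key≢k ∘ sym)) (≤-trans <k+j (≤-reflexive (+-suc k j))))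

  buckets-unique : ∀ k j {xs} → Unique xs → Unique (buckets k j xs)
  buckets-unique k zero uxs = []
  buckets-unique k (suc j) {xs} uxs =
    UniqueP.++⁺ (UniqueP.filter⁺ (λ x → key x ≟ℕ k) uxs) (buckets-unique (suc k) j uxs) disjoint
    where
      disjoint : ∀ {z} → ¬ (z ∈ filter (λ x → key x ≟ℕ k) xs × z ∈ buckets (suc k) j xs)
      disjoint (z∈bucket , z∈rest) with ∈-filter⁻ (λ x → key x ≟ℕ k) {xs = xs} z∈bucket
      ... | _ , refl = <-irrefl refl (proj₂ (buckets-sound (suc k) j xs z∈rest))

  buckets-sorted : ∀ k j xs → Sorted (buckets k j xs)
  buckets-sorted k zero xs = []
  buckets-sorted k (suc j) xs =
    AllPairsP.++⁺ (sorted-constant (AllP.all-filter (λ x → key x ≟ℕ k) xs)) (buckets-sorted (suc k) j xs)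
      (All.tabulate λ z∈bucket → All.tabulate λ y∈rest →
        ≤-trans (≤-reflexive (proj₂ (∈-filter⁻ (λ x → key x ≟ℕ k) {xs = xs} z∈bucket)))
                (<⇒≤ (proj₂ (buckets-sound (suc k) j xs y∈rest))))
    where
      sorted-constant : ∀ {ys} → All (λ z → key z ≡ k) ys → Sorted ys
      sorted-constant [] = []
      sorted-constant (kz ∷ kys) =
        All.map (λ ky → ≤-reflexive (trans kz (sym ky))) kys ∷ sorted-constant kys

  sorted-segment : ∀ {x} W {y} → Sorted (x ∷ W ∷ʳ y) →
    ∀ {z} → z ∈ x ∷ W ∷ʳ y → key x ≤ key z × key z ≤ key y
  sorted-segment W (x≤ ∷ _) (here refl) = ≤-refl , All.lookup x≤ (∈-++⁺ʳ W (here refl))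
  sorted-segment W (x≤ ∷ sorted) (there z∈) with ∈-++⁻ W z∈
  ... | inj₁ z∈W = All.lookup x≤ z∈ , allPairs-across W sorted z∈W (here refl)
  ... | inj₂ (here refl) = All.lookup x≤ z∈ , ≤-refl

  sorted-separated : ∀ n M → Unique M → Sorted M → n ≤ length M →
    (∀ {x} → x ∈ M → AtMost n (λ z → z ∈ M × key z ≡ key x)) →
    ∀ {x y} → (x , y) ∈ zip (take n M) (drop n M) → key x ≢ key y
  sorted-separated n M uM sM n≤|M| few {x} {y} xy∈ kx≡ky
    with zip-gap (take n M) [] (drop n M) xy∈
  ... | P , W , R , split , gap = <-irrefl refl (begin-strict
      n                    <⟨ ≤-reflexive (sym |X|≡1+n) ⟩
      length X             ≤⟨ few (X⊆M (here refl)) X uX (λ z∈X → X⊆M z∈X , sameKey z∈X) ⟩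
      n                    ∎)
    where
      open ≤-Reasoning
      X : List A
      X = x ∷ W ∷ʳ y
      M≡ : M ≡ P ++ X ++ R
      M≡ = trans (sym (take++drop≡id n M)) split
      X⊆M : X ⊆ M
      X⊆M z∈X = subst (_ ∈_) (sym M≡) (∈-++⁺ʳ P (∈-++⁺ˡ z∈X))
      uX : Unique X
      uX = allPairs-++ˡ X (allPairs-++ʳ P (subst Unique M≡ uM))
      sameKey : ∀ {z} → z ∈ X → key z ≡ key x
      sameKey z∈X with sorted-segment W (allPairs-++ˡ X (allPairs-++ʳ P (subst Sorted M≡ sM))) z∈X
      ... | x≤z , z≤y = ≤-antisym (≤-trans z≤y (≤-reflexive (sym kx≡ky))) x≤z
      |X|≡1+n : length X ≡ suc n
      |X|≡1+n = cong suc (begin-equality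
        length (W ∷ʳ y)     ≡⟨ trans (length-++ W) (+-comm (length W) 1) ⟩
        suc (length W)      ≡⟨ gap ⟩
        length (take n M) + 0 ≡⟨ +-identityʳ _ ⟩
        length (take n M)   ≡⟨ length-take n M ⟩
        n ⊓ length M        ≡⟨ m≤n⇒m⊓n≡m n≤|M| ⟩
        n                   ∎)

module Walks (G : Graph) where
  open Graph G using (m; irr) renaming (sym to adj-sym)
  open ListFacts

  V : Set
  V = Vertex G

  edge-sym : ∀ {a b} → Edge G a b → Edge G b a
  edge-sym {a} {b} e = trans (adj-sym b a) e

  edge-irrefl : ∀ {a b} → Edge G a b → a ≢ b
  edge-irrefl {a} e refl with () ← trans (sym e) (irr a)

  walk-head : ∀ {u x q} → Walk G u x q → Σ (List V) λ r → q ≡ u ∷ r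
  walk-head here = [] , refl
  walk-head (step {xs = xs} _ _) = xs , refl

  walk-last : ∀ {u x q} → Walk G u x q → x ∈ q
  walk-last here = here refl
  walk-last (step _ w) = there (walk-last w)

  walk-∷ʳ : ∀ {u x y q} → Walk G u x q → Edge G x y → Walk G u y (q ∷ʳ y)
  walk-∷ʳ here e = step e here
  walk-∷ʳ (step e' w) e = step e' (walk-∷ʳ w e)

  walk-reverse : ∀ {u x q} → Walk G u x q → Walk G x u (reverse q)
  walk-reverse here = here
  walk-reverse {u} (step {xs = xs} e w) =
    subst (Walk G _ u) (sym (unfold-reverse u xs)) (walk-∷ʳ (walk-reverse w) (edge-sym e))

  walk-tail : ∀ {u w x r} → Walk G u x (u ∷ w ∷ r) → Edge G u w × Walk G w x (w ∷ r)
  walk-tail (step e here) = e , here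
  walk-tail (step e (step e' w)) = e , step e' w

  walk-suffix : ∀ {u x q y} → Walk G u x q → y ∈ q →
    Σ (List V) λ P → Σ (List V) λ R → q ≡ P ++ y ∷ R × Walk G y x (y ∷ R)
  walk-suffix here (here refl) = [] , [] , refl , here
  walk-suffix (step {xs = xs} e w) (here refl) = [] , xs , refl , step e w
  walk-suffix {u} (step e w) (there y∈) with walk-suffix w y∈
  ... | P , R , refl , w' = u ∷ P , R , refl , w'

  path-length : ∀ {u x q} → IsPath G u x q → length q ≤ m
  path-length {q = q} (_ , uq) = begin
    length q          ≤⟨ unique-⊆-length uq (λ {z} _ → ∈-allFin z) ⟩
    length (allFin m) ≡⟨ length-tabulate (λ i → i) ⟩
    m                 ∎
    where open ≤-Reasoning

  consec-edge : ∀ {u x q a b} → Walk G u x q → Consec G a b q → Edge G a b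
  consec-edge (step e here) now = e
  consec-edge (step e (step _ _)) now = e
  consec-edge (step _ w) (later c) = consec-edge w c

  consec-∈₁ : ∀ {a b xs} → Consec G a b xs → a ∈ xs
  consec-∈₁ now = here refl
  consec-∈₁ (later c) = there (consec-∈₁ c)

  consec-∈₂ : ∀ {a b x xs} → Consec G a b (x ∷ xs) → b ∈ xs
  consec-∈₂ now = here refl
  consec-∈₂ {xs = _ ∷ _} (later c) = there (consec-∈₂ c)

  consec-++ˡ : ∀ {a b} xs ys → Consec G a b xs → Consec G a b (xs ++ ys)
  consec-++ˡ _ ys now = now
  consec-++ˡ (x ∷ xs) ys (later c) = later (consec-++ˡ xs ys c)

  consec-++ʳ : ∀ {a b} xs {ys} → Consec G a b ys → Consec G a b (xs ++ ys)
  consec-++ʳ [] c = c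
  consec-++ʳ (x ∷ xs) c = later (consec-++ʳ xs c)

  consec-∷ʳ : ∀ {a b} xs → Consec G a b (xs ∷ʳ a ∷ʳ b)
  consec-∷ʳ [] = now
  consec-∷ʳ (x ∷ xs) = later (consec-∷ʳ xs)

  consec-last : ∀ {u x q} y → Walk G u x q → Consec G x y (q ∷ʳ y)
  consec-last y here = now
  consec-last y (step _ w) = later (consec-last y w)

  consec-reverse : ∀ {a b} xs → Consec G a b xs → Consec G b a (reverse xs)
  consec-reverse (a ∷ b ∷ xs) now rewrite unfold-reverse a (b ∷ xs) | unfold-reverse b xs =
    consec-∷ʳ (reverse xs)
  consec-reverse (x ∷ xs) (later c) rewrite unfold-reverse x xs =
    consec-++ˡ (reverse xs) _ (consec-reverse xs c)

  consec-pred-unique : ∀ {a b x q} → Unique q → Consec G a x q → Consec G b x q → a ≡ b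
  consec-pred-unique _ now now = refl
  consec-pred-unique (_ ∷ (x∉ ∷ _)) now (later c) = ⊥-elim (All.lookup x∉ (consec-∈₂ c) refl)
  consec-pred-unique (_ ∷ (x∉ ∷ _)) (later c) now = ⊥-elim (All.lookup x∉ (consec-∈₂ c) refl)
  consec-pred-unique (_ ∷ uq) (later c) (later c') = consec-pred-unique uq c c'

  last-pred : ∀ {u w x r} → Walk G u x (u ∷ w ∷ r) → Σ V λ pe → Consec G pe x (u ∷ w ∷ r)
  last-pred {u} (step _ here) = u , now
  last-pred (step _ (step {u = w} _ here)) = w , later now
  last-pred (step _ (step e (step e' w))) with last-pred (step e (step e' w))
  ... | pe , c = pe , later c

  edgeOn-++ˡ : ∀ {a b} xs ys → EdgeOn G a b xs → EdgeOn G a b (xs ++ ys)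
  edgeOn-++ˡ xs ys (inj₁ c) = inj₁ (consec-++ˡ xs ys c)
  edgeOn-++ˡ xs ys (inj₂ c) = inj₂ (consec-++ˡ xs ys c)

  edgeOn-reverse : ∀ {a b} xs → EdgeOn G a b xs → EdgeOn G a b (reverse xs)
  edgeOn-reverse xs (inj₁ c) = inj₂ (consec-reverse xs c)
  edgeOn-reverse xs (inj₂ c) = inj₁ (consec-reverse xs c)

  sole-neighbour-leaf : ∀ {x pe} → Edge G x pe → (∀ y → Edge G x y → y ≡ pe) → Leaf G x
  sole-neighbour-leaf {x} {pe} x~pe only =
    pe ∷ [] , [] ∷ [] , refl , (λ { _ (here refl) → x~pe }) , λ y x~y → here (only y x~y)

module Acyclic (G : Graph) (acyclic : ¬ HasCycle G) where
  open Graph G using (m; adj)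
  open Walks G
  open ListFacts
  open import Data.List.Membership.DecPropositional (_≟F_ {m}) using (_∈?_)

  -- An edge from the end x of a path back to a vertex y of the path can only
  -- be the last edge of the path: anything else closes a cycle.
  back-edge : ∀ {u x q y} → IsPath G u x q → y ∈ q → Edge G x y → Consec G y x q
  back-edge (w , uq) y∈q x~y with walk-suffix w y∈q
  ... | P , [] , _ , here = ⊥-elim (edge-irrefl x~y refl)
  ... | P , _ ∷ [] , refl , step _ here = consec-++ʳ P now
  ... | P , c ∷ d ∷ R , refl , w' =
    ⊥-elim (acyclic (_ , _ , c , d , R , (w' , allPairs-++ʳ P uq) , x~y))

  extend-path : ∀ {u x pe y q} → IsPath G u x q → Consec G pe x q → Edge G x y → y ≢ pe →
    IsPath G u y (q ∷ʳ y)
  extend-path {y = y} {q} p pe→x x~y y≢pe with y ∈? q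
  ... | yes y∈q = ⊥-elim (y≢pe (consec-pred-unique (proj₂ p) (back-edge p y∈q x~y) pe→x))
  ... | no y∉q = walk-∷ʳ (proj₁ p) x~y , unique-∷ʳ (proj₂ p) y∉q

  NotFirst : V → List V → Set
  NotFirst a [] = ⊤
  NotFirst a (r ∷ _) = a ≢ r

  glue : ∀ {u e pe y} W R → IsPath G u e W → Consec G pe e W →
    Walk G e y (e ∷ R) → Unique (e ∷ R) → NotFirst pe R → IsPath G u y (W ++ R)
  glue {u} {e} W [] p _ here _ _ = subst (IsPath G u e) (sym (++-identityʳ W)) p
  glue {u} {e} {y = y} W (r ∷ R) p pe→e w (e∉ ∷ uR) pe≢r =
    subst (IsPath G u y) (++-assoc W (r ∷ []) R)
      (glue (W ∷ʳ r) R (extend-path p pe→e (proj₁ (walk-tail w)) (pe≢r ∘ sym))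
        (consec-last r (proj₁ p)) (proj₂ (walk-tail w)) uR (e-not-next R e∉))
    where
      e-not-next : ∀ R → All (e ≢_) (r ∷ R) → NotFirst e R
      e-not-next [] _ = tt
      e-not-next (_ ∷ _) (_ ∷ e≢r' ∷ _) = e≢r'

  join : ∀ {v x y s s' ps qs} → IsPath G v x (v ∷ s ∷ ps) → IsPath G v y (v ∷ s' ∷ qs) →
    s ≢ s' → IsPath G x y (reverse (v ∷ s ∷ ps) ++ s' ∷ qs)
  join {v} {s = s} {ps = ps} (wx , ux) (wy , uy) s≢s' =
    glue (reverse (v ∷ s ∷ ps)) _ (walk-reverse wx , unique-reverse ux)
      (consec-reverse (v ∷ s ∷ ps) now) wy uy s≢s'

  sole-neighbour : ∀ {x pe} → ¬ (∃ λ y → Edge G x y × y ≢ pe) → ∀ y → Edge G x y → y ≡ pe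
  sole-neighbour {pe = pe} none y x~y with y ≟F pe
  ... | yes y≡pe = y≡pe
  ... | no y≢pe = ⊥-elim (none (y , x~y , y≢pe))

  -- Greedily extending a path away from the predecessor of its end reaches a
  -- leaf.  The fuel k is enough since paths have at most m vertices.
  extend-to-leaf : ∀ k {u x pe q} → IsPath G u x q → Consec G pe x q → m < length q + k →
    Σ V λ ℓ → Σ (List V) λ r → Leaf G ℓ × IsPath G u ℓ (q ++ r)
  extend-to-leaf zero p _ m<|q| =
    ⊥-elim (<-irrefl refl (<-≤-trans m<|q| (≤-trans (≤-reflexive (+-identityʳ _)) (path-length p))))
  extend-to-leaf (suc k) {u} {x} {pe} {q} p pe→x m<
    with any? (λ y → (adj x y ≟B true) ×-dec ¬? (y ≟F pe))
  ... | no none =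
    x , [] , sole-neighbour-leaf (edge-sym (consec-edge (proj₁ p) pe→x)) (sole-neighbour none) ,
    subst (IsPath G u x) (sym (++-identityʳ q)) p
  ... | yes (y , x~y , y≢pe)
    with extend-to-leaf k (extend-path p pe→x x~y y≢pe) (consec-last y (proj₁ p))
           (<-≤-trans m< (≤-reflexive (sym (trans (cong (_+ k) (length-++ q)) (+-assoc (length q) 1 k)))))
  ... | ℓ , r , leaf , p' = ℓ , y ∷ r , leaf , subst (IsPath G u ℓ) (++-assoc q (y ∷ []) r) p'

-- A tree rooted at v.  Every vertex x ≠ v lies in the branch of the
-- neighbour `branch x` of v through which the path from v to x leaves v.
module Rooted (T : Graph) (tree : IsTree T) (v : Vertex T) where
  open Graph T using (m)
  open Walks T
  open ListFacts
  open Acyclic T (proj₂ tree)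
  open import Data.List.Membership.DecPropositional (_≟F_ {m}) using (_∈?_)

  -- branch x is the second vertex of the chosen path from v to x
  -- (v itself when x = v).
  second : List V → V
  second (_ ∷ s ∷ _) = s
  second _ = v

  branch : V → V
  branch x = second (proj₁ (proj₁ tree v x))

  branch-root : branch v ≡ v
  branch-root with proj₁ tree v v
  ... | _ , (here , _) = refl
  ... | _ , (step _ w , (v∉ ∷ _)) = ⊥-elim (All.lookup v∉ (walk-last w) refl)

  root-path : ∀ x → x ≢ v → Σ (List V) λ r → IsPath T v x (v ∷ branch x ∷ r)
  root-path x x≢v with proj₁ tree v x
  ... | _ , (here , _) = ⊥-elim (x≢v refl)
  ... | _ , (step {xs = _ ∷ r} e w , u) = r , step e w , u

  branch-adjacent : ∀ x → x ≢ v → Edge T v (branch x)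
  branch-adjacent x x≢v = proj₁ (walk-tail (proj₁ (proj₂ (root-path x x≢v))))

  path-end-≢ : ∀ {x s r} → IsPath T v x (v ∷ s ∷ r) → x ≢ v
  path-end-≢ (w , (v∉ ∷ _)) refl = All.lookup v∉ (walk-last (proj₂ (walk-tail w))) refl

  -- Any path from v to x leaves v through branch x: two different first
  -- steps would join into a path from x to x visiting x twice.
  branch-unique : ∀ {x s r} → IsPath T v x (v ∷ s ∷ r) → s ≡ branch x
  branch-unique {x} {s} {r} p with s ≟F branch x
  ... | yes s≡ = s≡
  ... | no s≢ with root-path x (path-end-≢ p)
  ...   | r' , p' = ⊥-elim (allPairs-across (reverse (v ∷ s ∷ r)) (proj₂ (join p p' s≢))
                      (AnyP.reverse⁺ (walk-last (proj₁ p))) (walk-last (proj₂ (walk-tail (proj₁ p')))) refl)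

  path-through-root : ∀ {x y s r} → IsPath T v x (v ∷ s ∷ r) → y ≢ v → s ≢ branch y →
    Σ (List V) λ t → IsPath T x y (reverse (v ∷ s ∷ r) ++ t)
  path-through-root {y = y} p y≢v s≢ with root-path y y≢v
  ... | r' , p' = branch y ∷ r' , join p p' s≢

  edgeOn-tail : ∀ {a b u r} → EdgeOn T a b (u ∷ r) → Σ V λ s → Σ (List V) λ r' → r ≡ s ∷ r'
  edgeOn-tail {r = s ∷ r'} _ = s , r' , refl
  edgeOn-tail {r = []} (inj₁ (later ()))
  edgeOn-tail {r = []} (inj₂ (later ()))

  RootPathThrough : V → V → V → Set
  RootPathThrough a b x =
    Σ V λ s → Σ (List V) λ r → IsPath T v x (v ∷ s ∷ r) × EdgeOn T a b (v ∷ s ∷ r)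

  as-root-path : ∀ {x q a b} → IsPath T v x q → EdgeOn T a b q → RootPathThrough a b x
  as-root-path p eo with walk-head (proj₁ p)
  ... | _ , refl with edgeOn-tail eo
  ...   | s , r , refl = s , r , p , eo

  -- Every edge lies on a path starting at v: the path from v to one endpoint,
  -- extended by the edge unless it already ends with it.
  edge-on-root-path : ∀ {a b} → Edge T a b → Σ V (RootPathThrough a b)
  edge-on-root-path {a} {b} a~b with proj₁ tree v a
  ... | q , p with b ∈? q
  ...   | yes b∈q = a , as-root-path p (inj₂ (back-edge p b∈q a~b))
  ...   | no b∉q = b , as-root-path (walk-∷ʳ (proj₁ p) a~b , unique-∷ʳ (proj₂ p) b∉q)
                                    (inj₁ (consec-last b (proj₁ p)))

  edge-toward-leaf : ∀ {a b} → Edge T a b → Σ V λ ℓ → Leaf T ℓ × RootPathThrough a b ℓ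
  edge-toward-leaf a~b with edge-on-root-path a~b
  ... | x , s , r , p , eo with last-pred (proj₁ p)
  ...   | pe , pe→x with extend-to-leaf m p pe→x (s≤s (≤-trans (m≤n+m m (length r)) (n≤1+n _)))
  ...     | ℓ , r' , leaf , p' = ℓ , leaf , s , r ++ r' , p' , edgeOn-++ˡ (v ∷ s ∷ r) r' eo

module Classes {A B : Set} (_≟_ : DecidableEquality B) (f : A → B) where

  sum-mono : ∀ {g h : B → ℕ} bs → (∀ b → g b ≤ h b) → sum (map g bs) ≤ sum (map h bs)
  sum-mono [] _ = z≤n
  sum-mono (b ∷ bs) g≤h = +-mono-≤ (g≤h b) (sum-mono bs g≤h)

  sum-zero : ∀ {g : B → ℕ} bs → (∀ b → g b ≡ 0) → sum (map g bs) ≡ 0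
  sum-zero [] _ = refl
  sum-zero (b ∷ bs) g≡0 = cong₂ _+_ (g≡0 b) (sum-zero bs g≡0)

  sum-+ : ∀ (g h : B → ℕ) bs → sum (map (λ b → g b + h b) bs) ≡ sum (map g bs) + sum (map h bs)
  sum-+ g h [] = refl
  sum-+ g h (b ∷ bs) = trans (cong (g b + h b +_) (sum-+ g h bs)) (interchange (g b) (h b) _ _)

  -- The summand of Σ { g b' : b' ∈ bs, c b', b' ≠ b }; with c = adj v this is
  -- the sum sumOtherNbrs in the definition of balance.
  others : (B → Bool) → B → (B → ℕ) → B → ℕ
  others c b g b' = if c b' ∧ not ⌊ b' ≟ b ⌋ then g b' else 0

  others-self : ∀ c b g → others c b g b ≡ 0
  others-self c b g with c b | b ≟ b
  ... | false | _ = refl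
  ... | true | yes _ = refl
  ... | true | no b≢b = ⊥-elim (b≢b refl)

  others-≤ : ∀ c b g b' → others c b g b' ≤ g b'
  others-≤ c b g b' with c b' ∧ not ⌊ b' ≟ b ⌋
  ... | true = ≤-refl
  ... | false = z≤n

  sum-others-≤ : ∀ c b g {bs} → Unique bs → b ∈ bs →
    sum (map (others c b g) bs) + g b ≤ sum (map g bs)
  sum-others-≤ c b g {b ∷ bs} _ (here refl) rewrite others-self c b g = begin
    sum (map (others c b g) bs) + g b ≡⟨ +-comm _ (g b) ⟩
    g b + sum (map (others c b g) bs) ≤⟨ +-monoʳ-≤ (g b) (sum-mono bs (others-≤ c b g)) ⟩
    g b + sum (map g bs)              ∎
    where open ≤-Reasoning
  sum-others-≤ c b g {b' ∷ bs} (_ ∷ ubs) (there b∈) = begin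
    others c b g b' + sum (map (others c b g) bs) + g b
      ≡⟨ +-assoc (others c b g b') _ (g b) ⟩
    others c b g b' + (sum (map (others c b g) bs) + g b)
      ≤⟨ +-mono-≤ (others-≤ c b g b') (sum-others-≤ c b g ubs b∈) ⟩
    g b' + sum (map g bs)
      ∎
    where open ≤-Reasoning

  sum-others-vanish : ∀ c b g bs → (∀ b' → c b' ≡ true → b' ≡ b) → sum (map (others c b g) bs) ≡ 0
  sum-others-vanish c b g bs only = sum-zero bs vanish
    where
      vanish : ∀ b' → others c b g b' ≡ 0
      vanish b' with c b' in cb'
      ... | false = refl
      ... | true with b' ≟ b
      ...   | yes _ = refl
      ...   | no b'≢b = ⊥-elim (b'≢b (only b' cb'))

  classSize : List A → B → ℕ
  classSize xs b = length (filter (λ x → f x ≟ b) xs)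

  indicator : B → B → ℕ
  indicator b b' = if ⌊ b ≟ b' ⌋ then 1 else 0

  classSize-∷ : ∀ x xs b → classSize (x ∷ xs) b ≡ indicator (f x) b + classSize xs b
  classSize-∷ x xs b with f x ≟ b
  ... | yes _ = refl
  ... | no _ = refl

  sum-indicator-∉ : ∀ {b} bs → b ∉ bs → sum (map (indicator b) bs) ≡ 0
  sum-indicator-∉ [] _ = refl
  sum-indicator-∉ {b} (b' ∷ bs) b∉ with b ≟ b'
  ... | yes b≡b' = ⊥-elim (b∉ (here b≡b'))
  ... | no _ = sum-indicator-∉ bs (b∉ ∘ there)

  sum-indicator : ∀ {b} bs → Unique bs → b ∈ bs → sum (map (indicator b) bs) ≡ 1
  sum-indicator {b} (b' ∷ bs) (b'∉ ∷ ubs) b∈ with b ≟ b'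
  ... | yes refl = cong suc (sum-indicator-∉ bs (λ b∈bs → All.lookup b'∉ b∈bs refl))
  ... | no b≢b' with b∈
  ...   | here b≡b' = ⊥-elim (b≢b' b≡b')
  ...   | there b∈bs = sum-indicator bs ubs b∈bs

  sum-classSize : ∀ bs → Unique bs → (∀ b → b ∈ bs) → ∀ xs → sum (map (classSize xs) bs) ≡ length xs
  sum-classSize bs ubs all∈ [] = sum-zero bs (λ _ → refl)
  sum-classSize bs ubs all∈ (x ∷ xs) = begin
    sum (map (classSize (x ∷ xs)) bs)
      ≡⟨ cong sum (map-cong (classSize-∷ x xs) bs) ⟩
    sum (map (λ b → indicator (f x) b + classSize xs b) bs)
      ≡⟨ sum-+ (indicator (f x)) (classSize xs) bs ⟩
    sum (map (indicator (f x)) bs) + sum (map (classSize xs) bs)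
      ≡⟨ cong₂ _+_ (sum-indicator bs ubs (all∈ (f x))) (sum-classSize bs ubs all∈ xs) ⟩
    suc (length xs)
      ∎
    where open ≡-Reasoning

module LeafPairing (T : Graph) (tree : IsTree T) (n : ℕ) (n≥1 : n ≥ 1)
                   (leaves : Card T (Leaf T) (2 * n)) (v : Vertex T) (balanced : Balanced T v) where
  open Graph T using (m; adj)
  open Walks T
  open ListFacts
  open Rooted T tree v
  open Classes _≟F_ branch

  L : List V
  L = proj₁ leaves

  L-unique : Unique L
  L-unique = proj₁ (proj₂ leaves)

  L-length : length L ≡ 2 * n
  L-length = proj₁ (proj₂ (proj₂ leaves))

  L-leaf : ∀ {x} → x ∈ L → Leaf T x
  L-leaf = proj₁ (proj₂ (proj₂ (proj₂ leaves))) _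

  leaf-L : ∀ {x} → Leaf T x → x ∈ L
  leaf-L = proj₂ (proj₂ (proj₂ (proj₂ leaves))) _

  delta-classSize : ∀ w → Edge T v w → Delta T v w (classSize L w)
  delta-classSize w v~w =
    filter (λ x → branch x ≟F w) L , UniqueP.filter⁺ _ L-unique , refl , sound , complete
    where
      sound : ∀ z → z ∈ filter (λ x → branch x ≟F w) L → Leaf T z × PathHasEdge T v z v w
      sound z z∈ with ∈-filter⁻ (λ x → branch x ≟F w) {xs = L} z∈
      ... | z∈L , refl with z ≟F v
      ...   | yes refl = ⊥-elim (edge-irrefl v~w (sym branch-root))
      ...   | no z≢v with root-path z z≢v
      ...     | r , p = L-leaf z∈L , v ∷ branch z ∷ r , p , inj₁ now
      -- A path from v containing {v , w} starts with this edge (v occurs only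
      -- at its head), so w is the branch of its end.
      complete : ∀ z → Leaf T z × PathHasEdge T v z v w → z ∈ filter (λ x → branch x ≟F w) L
      complete z (leaf , q , p , vw∈q) with as-root-path p vw∈q
      ... | s , r , p' , inj₁ now = ∈-filter⁺ (λ x → branch x ≟F w) (leaf-L leaf) (sym (branch-unique p'))
      ... | s , r , (_ , (v∉ ∷ _)) , inj₁ (later c) = ⊥-elim (All.lookup v∉ (consec-∈₁ c) refl)
      ... | s , r , (_ , (v∉ ∷ _)) , inj₂ c = ⊥-elim (All.lookup v∉ (consec-∈₂ c) refl)

  -- Balance bounds each branch by half of the leaves: 2 δ(v,w) ≤ Σ_{w'} δ(v,w') = 2n.
  branch-bound : ∀ w → Edge T v w → classSize L w ≤ n
  branch-bound w v~w = *-cancelˡ-≤ 2 (begin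
    2 * d w                      ≡⟨ cong (d w +_) (+-identityʳ (d w)) ⟩
    d w + d w                    ≤⟨ +-monoˡ-≤ (d w) (balanced d delta-classSize w v~w) ⟩
    sumOtherNbrs T v w d + d w   ≤⟨ sum-others-≤ (adj v) w d (UniqueP.allFin⁺ m) (∈-allFin w) ⟩
    sum (map d (allFin m))       ≡⟨ sum-classSize (allFin m) (UniqueP.allFin⁺ m) ∈-allFin L ⟩
    length L                     ≡⟨ L-length ⟩
    2 * n                        ∎)
    where
      open ≤-Reasoning
      d : V → ℕ
      d = classSize L

  avoid-root : ∀ xs → Unique xs → 2 ≤ length xs → Σ V λ x → x ∈ xs × x ≢ v
  avoid-root (_ ∷ []) _ (s≤s ())
  avoid-root (a ∷ b ∷ _) (a∉ ∷ _) _ with a ≟F v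
  ... | no a≢v = a , here refl , a≢v
  ... | yes refl = b , there (here refl) , λ b≡a → All.lookup a∉ (here refl) (sym b≡a)

  -- v is not a leaf: its unique neighbour w would have δ(v,w) = 0 by balance,
  -- yet the branch of w contains every leaf other than v.
  root-not-leaf : ¬ Leaf T v
  root-not-leaf (w ∷ [] , _ , refl , adjacent , only-w) =
    <-irrefl refl (<-≤-trans (filter-some (λ y → branch y ≟F w) in-branch-w) empty)
    where
      only : ∀ w' → adj v w' ≡ true → w' ≡ w
      only w' v~w' with only-w w' v~w'
      ... | here w'≡w = w'≡w
      empty : classSize L w ≤ 0
      empty = ≤-trans (balanced (classSize L) delta-classSize w (adjacent w (here refl)))
                      (≤-reflexive (sum-others-vanish (adj v) w (classSize L) (allFin m) only))
      other : Σ V λ x → x ∈ L × x ≢ v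
      other = avoid-root L L-unique (≤-trans (*-monoʳ-≤ 2 n≥1) (≤-reflexive (sym L-length)))
      in-branch-w : Any (λ y → branch y ≡ w) L
      in-branch-w with other
      ... | x , x∈L , x≢v = Any.map (λ { refl → only (branch x) (branch-adjacent x x≢v) }) x∈L

  leaf-≢-root : ∀ {x} → Leaf T x → x ≢ v
  leaf-≢-root leaf refl = root-not-leaf leaf

  key : V → ℕ
  key x = toℕ (branch x)

  open SortByKey key

  M : List V
  M = buckets 0 m L

  M⊆L : M ⊆ L
  M⊆L z∈M = proj₁ (buckets-sound 0 m L z∈M)

  L⊆M : L ⊆ M
  L⊆M {z} z∈L = buckets-complete 0 m L z∈L z≤n (toℕ<n (branch z))

  M-unique : Unique M
  M-unique = buckets-unique 0 m L-unique

  M-length : length M ≡ 2 * n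
  M-length = trans (≤-antisym (unique-⊆-length M-unique M⊆L) (unique-⊆-length L-unique L⊆M)) L-length

  M-few : ∀ {x} → x ∈ M → AtMost n (λ z → z ∈ M × key z ≡ key x)
  M-few {x} x∈M zs uzs zs-in-class =
    ≤-trans (atMost-⊆ (filter (λ y → branch y ≟F branch x) L) in-branch zs uzs zs-in-class)
            (branch-bound (branch x) (branch-adjacent x (leaf-≢-root (L-leaf (M⊆L x∈M)))))
    where
      in-branch : ∀ {z} → z ∈ M × key z ≡ key x → z ∈ filter (λ y → branch y ≟F branch x) L
      in-branch (z∈M , key≡) = ∈-filter⁺ (λ y → branch y ≟F branch x) (M⊆L z∈M) (toℕ-injective key≡)

  F S : List V
  F = take n M
  S = drop n M

  F++S : F ++ S ≡ M
  F++S = take++drop≡id n M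

  n≤|M| : n ≤ length M
  n≤|M| = ≤-trans (m≤m+n n (n + 0)) (≤-reflexive (sym M-length))

  |F|≡|S| : length F ≡ length S
  |F|≡|S| = begin
    length F        ≡⟨ length-take n M ⟩
    n ⊓ length M    ≡⟨ m≤n⇒m⊓n≡m n≤|M| ⟩
    n               ≡⟨ sym (m+n∸m≡n n n) ⟩
    n + n ∸ n       ≡⟨ cong (λ k → n + k ∸ n) (sym (+-identityʳ n)) ⟩
    2 * n ∸ n       ≡⟨ cong (_∸ n) (sym M-length) ⟩
    length M ∸ n    ≡⟨ sym (length-drop n M) ⟩
    length S        ∎
    where open ≡-Reasoning

  open Pairing (_≟F_ {m})

  involution : Σ (V → V) (ZipInvolution F S)
  involution = zipInvolution F S |F|≡|S| (subst Unique (sym F++S) M-unique)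

  α : V → V
  α = proj₁ involution

  separated : ∀ {x y} → (x , y) ∈ zip F S → key x ≢ key y
  separated = sorted-separated n M M-unique (buckets-sorted 0 m L) n≤|M| M-few

  separated-either : ∀ {x y} → (x , y) ∈ zip F S ⊎ (y , x) ∈ zip F S → branch x ≢ branch y
  separated-either (inj₁ xy∈) = separated xy∈ ∘ cong toℕ
  separated-either (inj₂ yx∈) = separated yx∈ ∘ cong toℕ ∘ sym

  α-properties : ∀ {ℓ} → Leaf T ℓ → Leaf T (α ℓ) × α (α ℓ) ≡ ℓ × branch ℓ ≢ branch (α ℓ)
  α-properties {ℓ} leaf =
    let α∈ , invol , zipped = proj₂ involution (subst (ℓ ∈_) (sym F++S) (L⊆M (leaf-L leaf)))
    in L-leaf (M⊆L (subst (α ℓ ∈_) F++S α∈)) , invol , separated-either zipped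

  α-leaf : ∀ ℓ → Leaf T ℓ → Leaf T (α ℓ)
  α-leaf _ leaf = proj₁ (α-properties leaf)

  α-involutive : ∀ ℓ → Leaf T ℓ → α (α ℓ) ≡ ℓ
  α-involutive _ leaf = proj₁ (proj₂ (α-properties leaf))

  partner-path : ∀ {ℓ s r} → Leaf T ℓ → IsPath T v ℓ (v ∷ s ∷ r) →
    Σ (List V) λ t → IsPath T ℓ (α ℓ) (reverse (v ∷ s ∷ r) ++ t)
  partner-path leaf p = path-through-root p (leaf-≢-root (α-leaf _ leaf))
    λ s≡ → proj₂ (proj₂ (α-properties leaf)) (trans (sym (branch-unique p)) s≡)

  through-root : ∀ ℓ → Leaf T ℓ → PathHasVertex T ℓ (α ℓ) v
  through-root ℓ leaf with root-path ℓ (leaf-≢-root leaf)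
  ... | r , p with partner-path leaf p
  ...   | t , q = _ , q , ∈-++⁺ˡ (AnyP.reverse⁺ {xs = v ∷ branch ℓ ∷ r} (here refl))

  covers : ∀ a b → Edge T a b → ∃ λ ℓ → Leaf T ℓ × PathHasEdge T ℓ (α ℓ) a b
  covers a b a~b with edge-toward-leaf a~b
  ... | ℓ , leaf , s , r , p , ab∈ with partner-path leaf p
  ...   | t , q = ℓ , leaf , _ , q , edgeOn-++ˡ (reverse (v ∷ s ∷ r)) t (edgeOn-reverse (v ∷ s ∷ r) ab∈)

-- The pairing α is a bijection of the leaves, being its own inverse (β = α).
lemma2 : (T : Graph) → IsTree T → (n : ℕ) → n ≥ 1 → Card T (Leaf T) (2 * n) →
    (v : Vertex T) → Balanced T v →
    Σ (Vertex T → Vertex T) λ α → Σ (Vertex T → Vertex T) λ β →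
      (∀ ℓ → Leaf T ℓ → Leaf T (α ℓ)) × (∀ ℓ → Leaf T ℓ → Leaf T (β ℓ)) ×
      (∀ ℓ → Leaf T ℓ → β (α ℓ) ≡ ℓ) × (∀ ℓ → Leaf T ℓ → α (β ℓ) ≡ ℓ) ×
      (∀ a b → Edge T a b → ∃ λ ℓ → Leaf T ℓ × PathHasEdge T ℓ (α ℓ) a b) ×
      (∀ ℓ → Leaf T ℓ → PathHasVertex T ℓ (α ℓ) v)
lemma2 T tree n n≥1 leaves v balanced =
  α , α , α-leaf , α-leaf , α-involutive , α-involutive , covers , through-root
  where open LeafPairing T tree n n≥1 leaves v balanced
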